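{- Let $M$ be a term and $V$ a value. (1) If $M\to_{\mathsf v}^* V$, then there exists a value $V'$ such that $M\to_{h\beta_v}^* V' \to_{int}^* V$. (2) $M\to_{h\beta_v}^* V$ if and only if $M\to_h^* V$.
   Context: Terms and values of the call-by-value $\lambda$-calculus are defined by mutual induction from a countably infinite set of variables: values $V,U ::= x \mid \lambda x.M$ and terms $M,N,L ::= V \mid MN$. Terms are taken up to $\alpha$-conversion, application associates to the left, $\mathrm{fv}(M)$ is the set of free variables, and $M\{V/x\}$ is capture-avoiding substitution of the value $V$ for $x$. Root rules: $(\lambda x.M)V \mapsto_{\beta_v} M\{V/x\}$ ($V$ a value); $(\lambda x.M)NL \mapsto_{\sigma_1} (\lambda x.ML)N$ if $x\notin\mathrm{fv}(L)$; $V((\lambda x.L)N) \mapsto_{\sigma_3} (\lambda x.VL)N$ ($V$ a value, $x\notin\mathrm{fv}(V)$). $\mapsto_\sigma=\mapsto_{\sigma_1}\cup\mapsto_{\sigma_3}$, $\mapsto_{\mathsf v}=\mapsto_{\beta_v}\cup\mapsto_\sigma$; $\to_r$ is the closure of $\mapsto_r$ under one-hole contexts $C ::= [\cdot]\mid \lambda x.C\mid CM\mid MC$. $R^*$ is the reflexive-transitive closure of $R$. Head $\beta_v$-reduction $\to_{h\beta_v}$ is the least relation with: $(\lambda x.M)V M_1\dots M_m \to_{h\beta_v} M\{V/x\}M_1\dots M_m$ ($V$ value, $m\ge0$); if $N\to_{h\beta_v}N'$ then $VNM_1\dots M_m\to_{h\beta_v}VN'M_1\dots M_m$ ($V$ value).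 Head $\sigma$-reduction $\to_{h\sigma}$ is the least relation with: $(\lambda x.M)NLM_1\dots M_m\to_{h\sigma}(\lambda x.ML)NM_1\dots M_m$ ($x\notin\mathrm{fv}(L)$); $V((\lambda x.L)N)M_1\dots M_m\to_{h\sigma}(\lambda x.VL)NM_1\dots M_m$ ($V$ value, $x\notin\mathrm{fv}(V)$); if $N\to_{h\sigma}N'$ then $VNM_1\dots M_m\to_{h\sigma}VN'M_1\dots M_m$ ($V$ value). $\to_h=\to_{h\beta_v}\cup\to_{h\sigma}$ and $\to_{int}=\to_{\mathsf v}\setminus\to_h$. -}

module Defs where

-- Call-by-value λ-calculus with terms up to α-conversion, represented by
-- well-scoped de Bruijn indices: Term n = terms with free variables among n.

open import Data.Nat using (ℕ; zero; suc)
open import Data.Fin using (Fin; zero; suc)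
open import Data.List using (List; []; _∷_)
open import Data.Product using (_×_)
open import Data.Sum using (_⊎_)
open import Relation.Nullary using (¬_)
open import Relation.Binary.Construct.Closure.ReflexiveTransitive using (Star)

infixl 7 _·_

data Term (n : ℕ) : Set where
  var : Fin n → Term n
  lam : Term (suc n) → Term n
  _·_ : Term n → Term n → Term n

data Value {n : ℕ} : Term n → Set where
  var : (i : Fin n) → Value (var i)
  lam : (M : Term (suc n)) → Value (lam M)

ext : ∀ {m n} → (Fin m → Fin n) → Fin (suc m) → Fin (suc n)
ext ρ zero    = zero
ext ρ (suc i) = suc (ρ i)

rename : ∀ {m n} → (Fin m → Fin n) → Term m → Term n
rename ρ (var i) = var (ρ i)
rename ρ (lam M) = lam (rename (ext ρ) M)
rename ρ (M · N) = rename ρ M · rename ρ N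

weaken : ∀ {n} → Term n → Term (suc n)
weaken = rename suc

exts : ∀ {m n} → (Fin m → Term n) → Fin (suc m) → Term (suc n)
exts σ zero    = var zero
exts σ (suc i) = weaken (σ i)

subst : ∀ {m n} → (Fin m → Term n) → Term m → Term n
subst σ (var i) = σ i
subst σ (lam M) = lam (subst (exts σ) M)
subst σ (M · N) = subst σ M · subst σ N

-- M{V/x} where x is the variable bound by the outermost binder (index 0)
sub0 : ∀ {n} → Term n → Fin (suc n) → Term n
sub0 V zero    = V
sub0 V (suc i) = var i

_[_] : ∀ {n} → Term (suc n) → Term n → Term n
M [ V ] = subst (sub0 V) M

data _↦βv_ {n : ℕ} : Term n → Term n → Set where
  βv : ∀ {M V} → Value V → (lam M · V) ↦βv (M [ V ])

-- σ1: (λx.M) N L ↦ (λx. M L) N, x ∉ fv(L)  (L is weakened under the binder)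
-- σ3: V ((λx.L) N) ↦ (λx. V L) N, x ∉ fv(V)
data _↦σ_ {n : ℕ} : Term n → Term n → Set where
  σ1 : ∀ {M N L} → (lam M · N · L) ↦σ (lam (M · weaken L) · N)
  σ3 : ∀ {V L N} → Value V → (V · (lam L · N)) ↦σ (lam (weaken V · L) · N)

data _↦v_ {n : ℕ} : Term n → Term n → Set where
  βv : ∀ {M N} → M ↦βv N → M ↦v N
  σ  : ∀ {M N} → M ↦σ N → M ↦v N

data _→v_ {n : ℕ} : Term n → Term n → Set where
  root : ∀ {M N} → M ↦v N → M →v N
  ξλ   : ∀ {M N : Term (suc n)} → M →v N → lam M →v lam N
  ξl   : ∀ {M M' N} → M →v M' → (M · N) →v (M' · N)
  ξr   : ∀ {M N N'} → N →v N' → (M · N) →v (M · N')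

_·*_ : ∀ {n} → Term n → List (Term n) → Term n
M ·* []       = M
M ·* (N ∷ Ns) = (M · N) ·* Ns

data _→hβv_ {n : ℕ} : Term n → Term n → Set where
  hβ  : ∀ {M V} (Ms : List (Term n)) → Value V →
        ((lam M · V) ·* Ms) →hβv ((M [ V ]) ·* Ms)
  hξ  : ∀ {V N N'} (Ms : List (Term n)) → Value V → N →hβv N' →
        ((V · N) ·* Ms) →hβv ((V · N') ·* Ms)

data _→hσ_ {n : ℕ} : Term n → Term n → Set where
  hσ1 : ∀ {M N L} (Ms : List (Term n)) →
        ((lam M · N · L) ·* Ms) →hσ ((lam (M · weaken L) · N) ·* Ms)
  hσ3 : ∀ {V L N} (Ms : List (Term n)) → Value V →
        ((V · (lam L · N)) ·* Ms) →hσ ((lam (weaken V · L) · N) ·* Ms)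
  hξ  : ∀ {V N N'} (Ms : List (Term n)) → Value V → N →hσ N' →
        ((V · N) ·* Ms) →hσ ((V · N') ·* Ms)

_→h_ : ∀ {n} → Term n → Term n → Set
M →h N = (M →hβv N) ⊎ (M →hσ N)

_→int_ : ∀ {n} → Term n → Term n → Set
M →int N = (M →v N) × ¬ (M →h N)

_→v*_ : ∀ {n} → Term n → Term n → Set
_→v*_ = Star _→v_

_→hβv*_ : ∀ {n} → Term n → Term n → Set
_→hβv*_ = Star _→hβv_

_→h*_ : ∀ {n} → Term n → Term n → Set
_→h*_ = Star _→h_

_→int*_ : ∀ {n} → Term n → Term n → Set
_→int*_ = Star _→int_

-- Takahashi's method with parallel reduction ⇛. A parallel step factors into
-- head steps followed by an internal parallel step ⇛ᵢ, and an internal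
-- parallel step followed by a head step is again a parallel step. Pushing head
-- steps to the front along M →v* V thus gives M →h* V' →v* V, where V' is a
-- value because internal steps do not create values, and no step out of a
-- value is a head step. Finally a head σ-step can be postponed past a head
-- βv-step, and no σ-step ends in a value, so head reductions to a value can be
-- made σ-free.

module Submission where

open import Defs
open import Data.Nat using (ℕ; zero; suc)
open import Data.Fin using (Fin; zero; suc)
open import Data.List using ([]; _∷_; _++_)
open import Data.Product using (_×_; Σ-syntax; ∃-syntax; _,_)
open import Data.Sum using (_⊎_; inj₁; inj₂)
open import Data.Empty using (⊥-elim)
open import Relation.Nullary using (¬_)
open import Relation.Binary.PropositionalEquality as ≡ using (_≡_; _≗_; refl; sym; trans; cong; cong₂)
open import Relation.Binary.Construct.Closure.ReflexiveTransitive using (Star; ε; _◅_; _◅◅_; gmap)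
open import Function using (_∘_; id)
open import Function.Bundles using (_⇔_; mk⇔)

private
  variable
    k m n : ℕ

ext-cong : {ρ ρ' : Fin m → Fin n} → ρ ≗ ρ' → ext ρ ≗ ext ρ'
ext-cong e zero    = refl
ext-cong e (suc i) = cong suc (e i)

rename-cong : {ρ ρ' : Fin m → Fin n} → ρ ≗ ρ' → rename ρ ≗ rename ρ'
rename-cong e (var i) = cong var (e i)
rename-cong e (lam M) = cong lam (rename-cong (ext-cong e) M)
rename-cong e (M · N) = cong₂ _·_ (rename-cong e M) (rename-cong e N)

rename-∘ : (ρ : Fin m → Fin n) (ρ' : Fin k → Fin m) (M : Term k) →
           rename ρ (rename ρ' M) ≡ rename (ρ ∘ ρ') M
rename-∘ ρ ρ' (var i) = refl
rename-∘ ρ ρ' (lam M) =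
  cong lam (trans (rename-∘ (ext ρ) (ext ρ') M) (rename-cong (λ { zero → refl ; (suc i) → refl }) M))
rename-∘ ρ ρ' (M · N) = cong₂ _·_ (rename-∘ ρ ρ' M) (rename-∘ ρ ρ' N)

rename-weaken : (ρ : Fin m → Fin n) (L : Term m) → rename (ext ρ) (weaken L) ≡ weaken (rename ρ L)
rename-weaken ρ L = trans (rename-∘ (ext ρ) suc L) (sym (rename-∘ suc ρ L))

exts-cong : {s s' : Fin m → Term n} → s ≗ s' → exts s ≗ exts s'
exts-cong e zero    = refl
exts-cong e (suc i) = cong weaken (e i)

subst-cong : {s s' : Fin m → Term n} → s ≗ s' → subst s ≗ subst s'
subst-cong e (var i) = e i
subst-cong e (lam M) = cong lam (subst-cong (exts-cong e) M)
subst-cong e (M · N) = cong₂ _·_ (subst-cong e M) (subst-cong e N)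

rename-subst : (ρ : Fin m → Fin n) (s : Fin k → Term m) (M : Term k) →
               rename ρ (subst s M) ≡ subst (rename ρ ∘ s) M
rename-subst ρ s (var i) = refl
rename-subst ρ s (lam M) =
  cong lam (trans (rename-subst (ext ρ) (exts s) M)
                  (subst-cong (λ { zero → refl ; (suc i) → rename-weaken ρ (s i) }) M))
rename-subst ρ s (M · N) = cong₂ _·_ (rename-subst ρ s M) (rename-subst ρ s N)

subst-rename : (s : Fin m → Term n) (ρ : Fin k → Fin m) (M : Term k) →
               subst s (rename ρ M) ≡ subst (s ∘ ρ) M
subst-rename s ρ (var i) = refl
subst-rename s ρ (lam M) =
  cong lam (trans (subst-rename (exts s) (ext ρ) M) (subst-cong (λ { zero → refl ; (suc i) → refl }) M))
subst-rename s ρ (M · N) = cong₂ _·_ (subst-rename s ρ M) (subst-rename s ρ N)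

subst-weaken : (s : Fin m → Term n) (L : Term m) → subst (exts s) (weaken L) ≡ weaken (subst s L)
subst-weaken s L = trans (subst-rename (exts s) suc L) (sym (rename-subst suc s L))

subst-∘ : (s : Fin m → Term n) (t : Fin k → Term m) (M : Term k) →
          subst s (subst t M) ≡ subst (subst s ∘ t) M
subst-∘ s t (var i) = refl
subst-∘ s t (lam M) =
  cong lam (trans (subst-∘ (exts s) (exts t) M)
                  (subst-cong (λ { zero → refl ; (suc i) → subst-weaken s (t i) }) M))
subst-∘ s t (M · N) = cong₂ _·_ (subst-∘ s t M) (subst-∘ s t N)

subst-var : (M : Term n) → subst var M ≡ M
subst-var (var i) = refl
subst-var (lam M) = cong lam (trans (subst-cong (λ { zero → refl ; (suc i) → refl }) M) (subst-var M))
subst-var (M · N) = cong₂ _·_ (subst-var M) (subst-var N)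

weaken-[] : (L W : Term n) → weaken L [ W ] ≡ L
weaken-[] L W = trans (subst-rename (sub0 W) suc L) (subst-var L)

rename-[] : (ρ : Fin m → Fin n) (P : Term (suc m)) (U : Term m) →
            rename ρ (P [ U ]) ≡ rename (ext ρ) P [ rename ρ U ]
rename-[] ρ P U =
  trans (rename-subst ρ (sub0 U) P)
        (trans (subst-cong (λ { zero → refl ; (suc i) → refl }) P)
               (sym (subst-rename (sub0 (rename ρ U)) (ext ρ) P)))

_∷ₛ_ : Term n → (Fin m → Term n) → Fin (suc m) → Term n
(W ∷ₛ s) zero    = W
(W ∷ₛ s) (suc i) = s i

subst-[]-∷ₛ : (s : Fin m → Term n) (P : Term (suc m)) (U : Term m) →
              subst s (P [ U ]) ≡ subst (subst s U ∷ₛ s) P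
subst-[]-∷ₛ s P U = trans (subst-∘ s (sub0 U) P) (subst-cong (λ { zero → refl ; (suc i) → refl }) P)

exts-[]-∷ₛ : (s : Fin m → Term n) (P : Term (suc m)) (W : Term n) →
             subst (exts s) P [ W ] ≡ subst (W ∷ₛ s) P
exts-[]-∷ₛ s P W =
  trans (subst-∘ (sub0 W) (exts s) P) (subst-cong (λ { zero → refl ; (suc i) → weaken-[] (s i) W }) P)

subst-[] : (s : Fin m → Term n) (P : Term (suc m)) (U : Term m) →
           subst s (P [ U ]) ≡ subst (exts s) P [ subst s U ]
subst-[] s P U = trans (subst-[]-∷ₛ s P U) (sym (exts-[]-∷ₛ s P (subst s U)))

Values : (Fin m → Term n) → Set
Values s = ∀ i → Value (s i)

·-¬Value : {M N : Term n} → ¬ Value (M · N)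
·-¬Value ()

rename-Value : (ρ : Fin m → Fin n) {V : Term m} → Value V → Value (rename ρ V)
rename-Value ρ (var i) = var (ρ i)
rename-Value ρ (lam M) = lam _

subst-Value : {s : Fin m → Term n} → Values s → {V : Term m} → Value V → Value (subst s V)
subst-Value vs (var i) = vs i
subst-Value vs (lam M) = lam _

exts-Values : {s : Fin m → Term n} → Values s → Values (exts s)
exts-Values vs zero    = var zero
exts-Values vs (suc i) = rename-Value suc (vs i)

∷ₛ-Values : {W : Term n} {s : Fin m → Term n} → Value W → Values s → Values (W ∷ₛ s)
∷ₛ-Values w vs zero    = w
∷ₛ-Values w vs (suc i) = vs i

-- Head reduction as closure under evaluation contexts E ::= [·] | E M | V E

data Head (R : Term n → Term n → Set) : Term n → Term n → Set where
  root : ∀ {M N} → R M N → Head R M N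
  appL : ∀ {M M' N} → Head R M M' → Head R (M · N) (M' · N)
  appR : ∀ {V N N'} → Value V → Head R N N' → Head R (V · N) (V · N')

Head* : (Term n → Term n → Set) → Term n → Term n → Set
Head* R = Star (Head R)

Head-map : {R R' : Term n → Term n → Set} → (∀ {M N} → R M N → R' M N) →
           ∀ {M N} → Head R M N → Head R' M N
Head-map f (root r)   = root (f r)
Head-map f (appL h)   = appL (Head-map f h)
Head-map f (appR v h) = appR v (Head-map f h)

appL* : {R : Term n → Term n → Set} {M M' N : Term n} → Head* R M M' → Head* R (M · N) (M' · N)
appL* = gmap _ appL

appR* : {R : Term n → Term n → Set} {V N N' : Term n} → Value V → Head* R N N' → Head* R (V · N) (V · N')
appR* v = gmap _ (appR v)

Head-¬Value : {M N : Term n} → Head _↦v_ M N → ¬ Value M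
Head-¬Value (root (βv (βv _))) ()
Head-¬Value (root (σ σ1))      ()
Head-¬Value (root (σ (σ3 _)))  ()

Headσ-¬Value : {M N : Term n} → Head _↦σ_ M N → ¬ Value N
Headσ-¬Value (root σ1)     ()
Headσ-¬Value (root (σ3 _)) ()

Head-split : {M N : Term n} → Head _↦v_ M N → Head _↦βv_ M N ⊎ Head _↦σ_ M N
Head-split (root (βv r)) = inj₁ (root r)
Head-split (root (σ r))  = inj₂ (root r)
Head-split (appL h) with Head-split h
... | inj₁ b = inj₁ (appL b)
... | inj₂ s = inj₂ (appL s)
Head-split (appR v h) with Head-split h
... | inj₁ b = inj₁ (appR v b)
... | inj₂ s = inj₂ (appR v s)

infix 4 _⇛_ _⇛ᵢ_

data _⇛_ {n : ℕ} : Term n → Term n → Set where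
  var : ∀ i → var i ⇛ var i
  lam : ∀ {P P'} → P ⇛ P' → lam P ⇛ lam P'
  app : ∀ {M M' N N'} → M ⇛ M' → N ⇛ N' → M · N ⇛ M' · N'
  βv  : ∀ {P P' U U'} → Value U → P ⇛ P' → U ⇛ U' → lam P · U ⇛ P' [ U' ]
  σ1  : ∀ {P P' Q Q' L L'} → P ⇛ P' → Q ⇛ Q' → L ⇛ L' →
        lam P · Q · L ⇛ lam (P' · weaken L') · Q'
  σ3  : ∀ {U U' L L' Q Q'} → Value U → U ⇛ U' → L ⇛ L' → Q ⇛ Q' →
        U · (lam L · Q) ⇛ lam (weaken U' · L') · Q'

-- No redex in head position is contracted.
data _⇛ᵢ_ {n : ℕ} : Term n → Term n → Set where
  var  : ∀ i → var i ⇛ᵢ var i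
  lam  : ∀ {P P'} → P ⇛ P' → lam P ⇛ᵢ lam P'
  appL : ∀ {A B M' N N'} → A · B ⇛ᵢ M' → N ⇛ N' → A · B · N ⇛ᵢ M' · N'
  appR : ∀ {V V' N N'} → Value V → V ⇛ V' → N ⇛ᵢ N' → V · N ⇛ᵢ V' · N'

⇛-refl : (M : Term n) → M ⇛ M
⇛-refl (var i) = var i
⇛-refl (lam M) = lam (⇛-refl M)
⇛-refl (M · N) = app (⇛-refl M) (⇛-refl N)

⇛ᵢ⇒⇛ : {M N : Term n} → M ⇛ᵢ N → M ⇛ N
⇛ᵢ⇒⇛ (var i)      = var i
⇛ᵢ⇒⇛ (lam p)      = lam p
⇛ᵢ⇒⇛ (appL p q)   = app (⇛ᵢ⇒⇛ p) q
⇛ᵢ⇒⇛ (appR v p q) = app p (⇛ᵢ⇒⇛ q)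

Value-⇛⇒⇛ᵢ : {M N : Term n} → Value M → M ⇛ N → M ⇛ᵢ N
Value-⇛⇒⇛ᵢ (var i) (var .i) = var i
Value-⇛⇒⇛ᵢ (lam M) (lam p)  = lam p

⇛-Value : {M N : Term n} → Value M → M ⇛ N → Value N
⇛-Value (var i) (var .i) = var i
⇛-Value (lam M) (lam p)  = lam _

⇛ᵢ-Value⁻ : {M N : Term n} → M ⇛ᵢ N → Value N → Value M
⇛ᵢ-Value⁻ (var i) _ = var i
⇛ᵢ-Value⁻ (lam p) _ = lam _

rename-⇛ : (ρ : Fin m → Fin n) {M N : Term m} → M ⇛ N → rename ρ M ⇛ rename ρ N
rename-⇛ ρ (var i)   = var (ρ i)
rename-⇛ ρ (lam p)   = lam (rename-⇛ (ext ρ) p)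
rename-⇛ ρ (app p q) = app (rename-⇛ ρ p) (rename-⇛ ρ q)
rename-⇛ ρ (βv {P' = P'} {U' = U'} v p q) =
  ≡.subst (_ ⇛_) (sym (rename-[] ρ P' U'))
    (βv (rename-Value ρ v) (rename-⇛ (ext ρ) p) (rename-⇛ ρ q))
rename-⇛ ρ (σ1 {P' = P'} {Q' = Q'} {L' = L'} p q r) =
  ≡.subst (λ X → _ ⇛ lam (rename (ext ρ) P' · X) · rename ρ Q') (sym (rename-weaken ρ L'))
    (σ1 (rename-⇛ (ext ρ) p) (rename-⇛ ρ q) (rename-⇛ ρ r))
rename-⇛ ρ (σ3 {U' = U'} {L' = L'} {Q' = Q'} v u p q) =
  ≡.subst (λ X → _ ⇛ lam (X · rename (ext ρ) L') · rename ρ Q') (sym (rename-weaken ρ U'))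
    (σ3 (rename-Value ρ v) (rename-⇛ ρ u) (rename-⇛ (ext ρ) p) (rename-⇛ ρ q))

_⇛ₛ_ : (s s' : Fin m → Term n) → Set
s ⇛ₛ s' = ∀ i → s i ⇛ s' i

exts-⇛ₛ : {s s' : Fin m → Term n} → s ⇛ₛ s' → exts s ⇛ₛ exts s'
exts-⇛ₛ ps zero    = var zero
exts-⇛ₛ ps (suc i) = rename-⇛ suc (ps i)

∷ₛ-⇛ₛ : {W W' : Term n} {s s' : Fin m → Term n} → W ⇛ W' → s ⇛ₛ s' → (W ∷ₛ s) ⇛ₛ (W' ∷ₛ s')
∷ₛ-⇛ₛ p ps zero    = p
∷ₛ-⇛ₛ p ps (suc i) = ps i

-- Only values may be substituted: a βv-redex must stay one.
subst-⇛ : {s s' : Fin m → Term n} → Values s → s ⇛ₛ s' →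
          {M N : Term m} → M ⇛ N → subst s M ⇛ subst s' N
subst-⇛ vs ps (var i)   = ps i
subst-⇛ vs ps (lam p)   = lam (subst-⇛ (exts-Values vs) (exts-⇛ₛ ps) p)
subst-⇛ vs ps (app p q) = app (subst-⇛ vs ps p) (subst-⇛ vs ps q)
subst-⇛ {s' = s'} vs ps (βv {P' = P'} {U' = U'} v p q) =
  ≡.subst (_ ⇛_) (sym (subst-[] s' P' U'))
    (βv (subst-Value vs v) (subst-⇛ (exts-Values vs) (exts-⇛ₛ ps) p) (subst-⇛ vs ps q))
subst-⇛ {s' = s'} vs ps (σ1 {P' = P'} {Q' = Q'} {L' = L'} p q r) =
  ≡.subst (λ X → _ ⇛ lam (subst (exts s') P' · X) · subst s' Q') (sym (subst-weaken s' L'))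
    (σ1 (subst-⇛ (exts-Values vs) (exts-⇛ₛ ps) p) (subst-⇛ vs ps q) (subst-⇛ vs ps r))
subst-⇛ {s' = s'} vs ps (σ3 {U' = U'} {L' = L'} {Q' = Q'} v u p q) =
  ≡.subst (λ X → _ ⇛ lam (X · subst (exts s') L') · subst s' Q') (sym (subst-weaken s' U'))
    (σ3 (subst-Value vs v) (subst-⇛ vs ps u) (subst-⇛ (exts-Values vs) (exts-⇛ₛ ps) p) (subst-⇛ vs ps q))

weaken-⇛ : {M N : Term n} → M ⇛ N → weaken M ⇛ weaken N
weaken-⇛ = rename-⇛ suc

→v⇒⇛ : {M N : Term n} → M →v N → M ⇛ N
→v⇒⇛ (root (βv (βv v))) = βv v (⇛-refl _) (⇛-refl _)
→v⇒⇛ (root (σ σ1))      = σ1 (⇛-refl _) (⇛-refl _) (⇛-refl _)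
→v⇒⇛ (root (σ (σ3 v)))  = σ3 v (⇛-refl _) (⇛-refl _) (⇛-refl _)
→v⇒⇛ (ξλ s)             = lam (→v⇒⇛ s)
→v⇒⇛ (ξl s)             = app (→v⇒⇛ s) (⇛-refl _)
→v⇒⇛ (ξr s)             = app (⇛-refl _) (→v⇒⇛ s)

lam-→v* : {M N : Term (suc n)} → M →v* N → lam M →v* lam N
lam-→v* = gmap _ ξλ

app-→v* : {M M' N N' : Term n} → M →v* M' → N →v* N' → (M · N) →v* (M' · N')
app-→v* p q = gmap _ ξl p ◅◅ gmap _ ξr q

⇛⇒→v* : {M N : Term n} → M ⇛ N → M →v* N
⇛⇒→v* (var i)   = ε
⇛⇒→v* (lam p)   = lam-→v* (⇛⇒→v* p)
⇛⇒→v* (app p q) = app-→v* (⇛⇒→v* p) (⇛⇒→v* q)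
⇛⇒→v* (βv v p q) =
  app-→v* (lam-→v* (⇛⇒→v* p)) (⇛⇒→v* q) ◅◅ root (βv (βv (⇛-Value v q))) ◅ ε
⇛⇒→v* (σ1 p q r) =
  app-→v* (app-→v* (lam-→v* (⇛⇒→v* p)) (⇛⇒→v* q)) (⇛⇒→v* r) ◅◅ root (σ σ1) ◅ ε
⇛⇒→v* (σ3 v u p q) =
  app-→v* (⇛⇒→v* u) (app-→v* (lam-→v* (⇛⇒→v* p)) (⇛⇒→v* q)) ◅◅ root (σ (σ3 (⇛-Value v u))) ◅ ε

-- Factorisation into head steps and internal steps

HeadThenInternal : Term n → Term n → Set
HeadThenInternal M N = ∃[ M₀ ] (Head* _↦v_ M M₀ × M₀ ⇛ᵢ N)

·-HeadThenInternal : {M M₀ M' N N' : Term n} → Head* _↦v_ M M₀ → M₀ ⇛ᵢ M' → N ⇛ N' →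
                     HeadThenInternal N N' → HeadThenInternal (M · N) (M' · N')
·-HeadThenInternal hs (var i) _ (_ , hs' , d') = _ , appL* hs ◅◅ appR* (var i) hs' , appR (var i) (var i) d'
·-HeadThenInternal hs (lam p) _ (_ , hs' , d') = _ , appL* hs ◅◅ appR* (lam _) hs' , appR (lam _) (lam p) d'
·-HeadThenInternal hs d@(appL _ _)   q _ = _ , appL* hs , appL d q
·-HeadThenInternal hs d@(appR _ _ _) q _ = _ , appL* hs , appL d q

-- Generalised over a parallel substitution of values so that the βv case can
-- recurse on the body of the abstraction.
subst-⇛-split : {s s' : Fin m → Term n} → Values s → s ⇛ₛ s' →
                {M N : Term m} → M ⇛ N → HeadThenInternal (subst s M) (subst s' N)
subst-⇛-split vs ps (var i) = _ , ε , Value-⇛⇒⇛ᵢ (vs i) (ps i)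
subst-⇛-split vs ps (lam p) = _ , ε , lam (subst-⇛ (exts-Values vs) (exts-⇛ₛ ps) p)
subst-⇛-split vs ps (app p q) with subst-⇛-split vs ps p
... | _ , hs , d = ·-HeadThenInternal hs d (subst-⇛ vs ps q) (subst-⇛-split vs ps q)
subst-⇛-split {s = s} {s'} vs ps (βv {P} {P'} {U} {U'} v p q)
  with subst-⇛-split (∷ₛ-Values (subst-Value vs v) vs) (∷ₛ-⇛ₛ (subst-⇛ vs ps q) ps) p
... | _ , hs , d =
  _ , ≡.subst (Head _↦v_ _) (exts-[]-∷ₛ s P (subst s U)) (root (βv (βv (subst-Value vs v)))) ◅ hs
    , ≡.subst (_ ⇛ᵢ_) (sym (subst-[]-∷ₛ s' P' U')) d
subst-⇛-split {s' = s'} vs ps (σ1 {L' = L'} p q r) with subst-⇛-split vs ps q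
... | _ , hs , d =
  _ , root (σ σ1) ◅ appR* (lam _) hs
    , appR (lam _) (lam (app (subst-⇛ (exts-Values vs) (exts-⇛ₛ ps) p)
                             (≡.subst (_ ⇛_) (sym (subst-weaken s' L')) (weaken-⇛ (subst-⇛ vs ps r)))))
           d
subst-⇛-split {s' = s'} vs ps (σ3 {U' = U'} v u p q) with subst-⇛-split vs ps q
... | _ , hs , d =
  _ , root (σ (σ3 (subst-Value vs v))) ◅ appR* (lam _) hs
    , appR (lam _) (lam (app (≡.subst (_ ⇛_) (sym (subst-weaken s' U')) (weaken-⇛ (subst-⇛ vs ps u)))
                             (subst-⇛ (exts-Values vs) (exts-⇛ₛ ps) p)))
           d

⇛-split : {M N : Term n} → M ⇛ N → HeadThenInternal M N
⇛-split {M = M} {N} p with subst-⇛-split var var p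
... | _ , hs , d = _ , ≡.subst (λ X → Head* _↦v_ X _) (subst-var M) hs , ≡.subst (_ ⇛ᵢ_) (subst-var N) d

⇛ᵢ-Head-merge : {M N N' : Term n} → M ⇛ᵢ N → Head _↦v_ N N' → M ⇛ N'
⇛ᵢ-Head-merge (appR (lam _) (lam p) q) (root (βv (βv w)))  = βv (⇛ᵢ-Value⁻ q w) p (⇛ᵢ⇒⇛ q)
⇛ᵢ-Head-merge (appL (appR (lam _) (lam p) q) r) (root (σ σ1)) = σ1 p (⇛ᵢ⇒⇛ q) r
⇛ᵢ-Head-merge (appR v p (appR (lam _) (lam l) q)) (root (σ (σ3 _))) = σ3 v p l (⇛ᵢ⇒⇛ q)
⇛ᵢ-Head-merge (appR v p _) (root (σ σ1))     = ⊥-elim (·-¬Value (⇛-Value v p))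
⇛ᵢ-Head-merge (appL d _)   (root (σ (σ3 w))) = ⊥-elim (·-¬Value (⇛ᵢ-Value⁻ d w))
⇛ᵢ-Head-merge (appL d q)   (appL h)   = app (⇛ᵢ-Head-merge d h) q
⇛ᵢ-Head-merge (appR _ p q) (appR _ h) = app p (⇛ᵢ-Head-merge q h)
⇛ᵢ-Head-merge (appR v p _) (appL h)   = ⊥-elim (Head-¬Value h (⇛-Value v p))
⇛ᵢ-Head-merge (appL d _)   (appR w _) = ⊥-elim (·-¬Value (⇛ᵢ-Value⁻ d w))

⇛-Head*-factorise : {M N W : Term n} → M ⇛ N → Head* _↦v_ N W → HeadThenInternal M W
⇛-Head*-factorise p ε = ⇛-split p
⇛-Head*-factorise p (h ◅ hs) with ⇛-split p
... | _ , hs₀ , d with ⇛-Head*-factorise (⇛ᵢ-Head-merge d h) hs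
... | _ , hs₁ , d' = _ , hs₀ ◅◅ hs₁ , d'

→v*-Value-factorise : {M V : Term n} → M →v* V → Value V →
                      ∃[ V' ] (Value V' × Head* _↦v_ M V' × V' →v* V)
→v*-Value-factorise ε v = _ , v , ε , ε
→v*-Value-factorise (s ◅ ss) v with →v*-Value-factorise ss v
... | _ , w , hs , ws with ⇛-Head*-factorise (→v⇒⇛ s) hs
... | _ , hs' , d = _ , ⇛ᵢ-Value⁻ d w , hs' , ⇛⇒→v* (⇛ᵢ⇒⇛ d) ◅◅ ws

-- Postponement of head σ-steps

Head-Value-¬βv : {V N : Term n} → Value V → ¬ Head _↦βv_ V N
Head-Value-¬βv v h = Head-¬Value (Head-map βv h) v

σ-βv-postpone : {M M' M'' : Term n} → Head _↦σ_ M M' → Head _↦βv_ M' M'' →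
                Head _↦βv_ M M'' ⊎ ∃[ M₀ ] (Head _↦βv_ M M₀ × Head _↦σ_ M₀ M'')
-- At the root, the βv-step contracts the redex the σ-step created; undoing the
-- σ-step turns this into a single βv-step on the original term.
σ-βv-postpone (root (σ1 {M = P} {N = Q} {L = L})) (root (βv w)) =
  inj₁ (≡.subst (λ X → Head _↦βv_ _ (P [ Q ] · X)) (sym (weaken-[] L Q)) (appL (root (βv w))))
σ-βv-postpone (root (σ3 {V = U} {L = L} {N = Q} v)) (root (βv w)) =
  inj₁ (≡.subst (λ X → Head _↦βv_ _ (X · L [ Q ])) (sym (weaken-[] U Q)) (appR v (root (βv w))))
σ-βv-postpone (root σ1)      (appR _ h) = inj₂ (_ , appL (appR (lam _) h) , root σ1)
σ-βv-postpone (root (σ3 v))  (appR _ h) = inj₂ (_ , appR v (appR (lam _) h) , root (σ3 v))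
σ-βv-postpone (root σ1)      (appL h)   = ⊥-elim (Head-Value-¬βv (lam _) h)
σ-βv-postpone (root (σ3 v))  (appL h)   = ⊥-elim (Head-Value-¬βv (lam _) h)
σ-βv-postpone (appL h) (appL h') with σ-βv-postpone h h'
... | inj₁ b            = inj₁ (appL b)
... | inj₂ (_ , b , s)  = inj₂ (_ , appL b , appL s)
σ-βv-postpone (appR v h) (appR _ h') with σ-βv-postpone h h'
... | inj₁ b            = inj₁ (appR v b)
... | inj₂ (_ , b , s)  = inj₂ (_ , appR v b , appR v s)
σ-βv-postpone (appL h)   (root (βv _)) = ⊥-elim (Headσ-¬Value h (lam _))
σ-βv-postpone (appL h)   (appR w _)    = ⊥-elim (Headσ-¬Value h w)
σ-βv-postpone (appR _ h) (root (βv w)) = ⊥-elim (Headσ-¬Value h w)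
σ-βv-postpone (appR v _) (appL h')     = ⊥-elim (Head-Value-¬βv v h')

σ◅βv*-Value : {M M' V : Term n} → Head _↦σ_ M M' → Head* _↦βv_ M' V → Value V → Head* _↦βv_ M V
σ◅βv*-Value s ε v = ⊥-elim (Headσ-¬Value s v)
σ◅βv*-Value s (b ◅ bs) v with σ-βv-postpone s b
... | inj₁ b'          = b' ◅ bs
... | inj₂ (_ , b' , s') = b' ◅ σ◅βv*-Value s' bs v

Head*-Value⇒βv* : {M V : Term n} → Head* _↦v_ M V → Value V → Head* _↦βv_ M V
Head*-Value⇒βv* ε v = ε
Head*-Value⇒βv* (h ◅ hs) v with Head-split h
... | inj₁ b = b ◅ Head*-Value⇒βv* hs v
... | inj₂ s = σ◅βv*-Value s (Head*-Value⇒βv* hs v) v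

-- Head reduction on argument spines agrees with head reduction in evaluation contexts

Head-·* : {R : Term n → Term n → Set} {A B : Term n} → ∀ Ms → Head R A B → Head R (A ·* Ms) (B ·* Ms)
Head-·* []       h = h
Head-·* (N ∷ Ns) h = Head-·* Ns (appL h)

→hβv⇒Head : {M N : Term n} → M →hβv N → Head _↦βv_ M N
→hβv⇒Head (hβ Ms v)   = Head-·* Ms (root (βv v))
→hβv⇒Head (hξ Ms v h) = Head-·* Ms (appR v (→hβv⇒Head h))

→hσ⇒Head : {M N : Term n} → M →hσ N → Head _↦σ_ M N
→hσ⇒Head (hσ1 Ms)    = Head-·* Ms (root σ1)
→hσ⇒Head (hσ3 Ms v)  = Head-·* Ms (root (σ3 v))
→hσ⇒Head (hξ Ms v h) = Head-·* Ms (appR v (→hσ⇒Head h))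

→h⇒Head : {M N : Term n} → M →h N → Head _↦v_ M N
→h⇒Head (inj₁ b) = Head-map βv (→hβv⇒Head b)
→h⇒Head (inj₂ s) = Head-map σ (→hσ⇒Head s)

·*-snoc : (M : Term n) → ∀ Ms N → (M ·* Ms) · N ≡ M ·* (Ms ++ N ∷ [])
·*-snoc M []       N = refl
·*-snoc M (L ∷ Ls) N = ·*-snoc (M · L) Ls N

→hβv-appL : {M M' N : Term n} → M →hβv M' → (M · N) →hβv (M' · N)
→hβv-appL {N = N} (hβ Ms v) =
  ≡.subst₂ _→hβv_ (sym (·*-snoc _ Ms N)) (sym (·*-snoc _ Ms N)) (hβ (Ms ++ N ∷ []) v)
→hβv-appL {N = N} (hξ Ms v h) =
  ≡.subst₂ _→hβv_ (sym (·*-snoc _ Ms N)) (sym (·*-snoc _ Ms N)) (hξ (Ms ++ N ∷ []) v h)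

Head⇒→hβv : {M N : Term n} → Head _↦βv_ M N → M →hβv N
Head⇒→hβv (root (βv v)) = hβ [] v
Head⇒→hβv (appL h)      = →hβv-appL (Head⇒→hβv h)
Head⇒→hβv (appR v h)    = hξ [] v (Head⇒→hβv h)

→v-Value : {V N : Term n} → Value V → V →v N → Value N
→v-Value (lam M) (ξλ s) = lam _
→v-Value (var i) (root (βv ()))
→v-Value (var i) (root (σ ()))
→v-Value (lam M) (root (βv ()))
→v-Value (lam M) (root (σ ()))

Value-→v*⇒→int* : {V N : Term n} → Value V → V →v* N → V →int* N
Value-→v*⇒→int* v ε        = ε
Value-→v*⇒→int* v (s ◅ ss) =
  (s , λ h → Head-¬Value (→h⇒Head h) v) ◅ Value-→v*⇒→int* (→v-Value v s) ss

corollary5p1 : ∀ {n : ℕ} (M V : Term n) → Value V →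
    ((M →v* V) → Σ[ V' ∈ Term n ] (Value V' × (M →hβv* V') × (V' →int* V)))
    × ((M →hβv* V) ⇔ (M →h* V))
corollary5p1 M V v = standardise , mk⇔ (gmap id inj₁) eliminate-σ
  where
  standardise : M →v* V → Σ[ V' ∈ Term _ ] (Value V' × (M →hβv* V') × (V' →int* V))
  standardise ss with →v*-Value-factorise ss v
  ... | V' , v' , hs , ws =
    V' , v' , gmap id Head⇒→hβv (Head*-Value⇒βv* hs v') , Value-→v*⇒→int* v' ws

  eliminate-σ : M →h* V → M →hβv* V
  eliminate-σ hs = gmap id Head⇒→hβv (Head*-Value⇒βv* (gmap id →h⇒Head hs) v)
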